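{- Let $W=\{(0^m),(1^m)\}$ be the repetition code in $H(m,2)$, and suppose $C$ is a non-trivial (i.e. $C\neq W$) $(X,2)$-neighbour-transitive extension of $W$ with minimum distance $\delta\geq 5$. Then $\delta\neq m$, $X^M$ acts $2$-transitively on $M$, and $X_W^M$ acts $2$-homogeneously on $M$. Moreover, if $X_W^M$ acts $2$-transitively on $M$, then for distinct $i,j\in M$ the group $X_{i,j}^M$ has a normal subgroup of index $2$.
   Context: The Hamming graph $H(m,2)$ has vertex set $\mathbb{F}_2^m$ indexed by entry set $M$, vertices adjacent iff they differ in exactly one entry. For a code $D$, $D_s$ is the set of vertices at distance exactly $s$ from $D$. $\mathrm{Aut}(H(m,2))=B\rtimes L$ with $B\cong\mathrm{Sym}(\{0,1\})^m$ acting coordinatewise and $L\cong\mathrm{Sym}(M)$ permuting entries; $\mathrm{Aut}(C)$ is the setwise stabiliser of $C$. For $X\leq\mathrm{Aut}(C)$, $C$ is $(X,2)$-neighbour-transitive if $X$ is transitive on each of $C$, $C_1$, $C_2$. $K=X\cap B$; $T_W=\{\alpha\mapsto\alpha+w:w\in W\}$; $K_W$ is the setwise stabiliser of $W$ in $K$. An $(X,2)$-neighbour-transitive extension of $W$ is an $(X,2)$-neighbour-transitive code $C$ with $\mathbf{0}\in C$, $T_W\leq X$ and $K=K_W$. $X_W$ is the setwise stabiliser of $W$ in $X$, $X_{i,j}$ the subgroup of $X$ fixing entries $i$ and $j$, and $Y^M$ the permutation group induced by $Y\leq X$ on $M$. A permutation group is $2$-homogeneous if transitive on unordered pairs of distinct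 points. -}

module Defs where

open import Data.Nat using (ℕ; zero; suc; _+_; _≤_)
open import Data.Bool using (Bool; true; false; _xor_; if_then_else_)
open import Data.Fin using (Fin)
open import Data.Vec using (Vec; []; _∷_; lookup; tabulate; replicate)
open import Data.Fin.Permutation as P using (Permutation′; _⟨$⟩ʳ_; _⟨$⟩ˡ_; _∘ₚ_)
open import Data.Product using (Σ; ∃; _×_; _,_)
open import Data.Sum using (_⊎_)
open import Relation.Binary.PropositionalEquality using (_≡_; _≢_)
open import Relation.Nullary using (¬_)

-- The Hamming graph H(m,2): vertices are F_2^m, entry set M = Fin m.

Vertex : ℕ → Set
Vertex m = Vec Bool m

dist : ∀ {m} → Vertex m → Vertex m → ℕ
dist [] [] = 0
dist (x ∷ xs) (y ∷ ys) = (if x xor y then 1 else 0) + dist xs ys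

Code : ℕ → Set₁
Code m = Vertex m → Set

zeroV : ∀ {m} → Vertex m
zeroV = replicate _ false

oneV : ∀ {m} → Vertex m
oneV = replicate _ true

Rep : ∀ {m} → Code m
Rep α = α ≡ zeroV ⊎ α ≡ oneV

Nbhd : ∀ {m} → Code m → ℕ → Code m
Nbhd D s α = (∃ λ c → D c × dist α c ≡ s) × (∀ c → D c → s ≤ dist α c)

IsMinDist : ∀ {m} → Code m → ℕ → Set
IsMinDist C δ =
  (∃ λ c → ∃ λ c′ → C c × C c′ × c ≢ c′ × dist c c′ ≡ δ)
  × (∀ c c′ → C c → C c′ → c ≢ c′ → δ ≤ dist c c′)

-- Aut(H(m,2)) = B ⋊ L: an element is a pair (b, σ), acting by
--   α ↦ σ(α) + b,   where σ(α)_{σ(j)} = α_j.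

record Aut (m : ℕ) : Set where
  constructor aut
  field
    shift : Vec Bool m
    perm  : Permutation′ m
open Aut public

act : ∀ {m} → Aut m → Vertex m → Vertex m
act g α = tabulate (λ i → lookup α (perm g ⟨$⟩ˡ i) xor lookup (shift g) i)

-- group operations (act (g · h) = act g ∘ act h)
idA : ∀ {m} → Aut m
idA = aut zeroV P.id

_·_ : ∀ {m} → Aut m → Aut m → Aut m
g · h = aut (tabulate (λ i → lookup (shift h) (perm g ⟨$⟩ˡ i) xor lookup (shift g) i))
            (perm h ∘ₚ perm g)

invA : ∀ {m} → Aut m → Aut m
invA g = aut (tabulate (λ i → lookup (shift g) (perm g ⟨$⟩ʳ i))) (P.flip (perm g))

_≈A_ : ∀ {m} → Aut m → Aut m → Set
g ≈A h = shift g ≡ shift h × perm g P.≈ perm h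

record IsSubgroup {m} (X : Aut m → Set) : Set where
  field
    resp  : ∀ {g h} → g ≈A h → X g → X h
    hasId : X idA
    mul   : ∀ {g h} → X g → X h → X (g · h)
    inv   : ∀ {g} → X g → X (invA g)

-- g fixes the code D setwise (g(D) = D; g is a bijection).
Stabilises : ∀ {m} → Aut m → Code m → Set
Stabilises g D = ∀ α → (D α → D (act g α)) × (D (act g α) → D α)

TransitiveOn : ∀ {m} → (Aut m → Set) → Code m → Set
TransitiveOn X D = ∀ α β → D α → D β → ∃ λ g → X g × act g α ≡ β

NeighbourTransitive2 : ∀ {m} → (Aut m → Set) → Code m → Set
NeighbourTransitive2 X C =
  (∀ g → X g → Stabilises g C)
  × TransitiveOn X C × TransitiveOn X (Nbhd C 1) × TransitiveOn X (Nbhd C 2)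

transl : ∀ {m} → Vertex m → Aut m
transl w = aut w P.id

InK : ∀ {m} → (Aut m → Set) → Aut m → Set
InK X g = X g × perm g P.≈ P.id

IsExtension : ∀ {m} → (Aut m → Set) → Code m → Code m → Set
IsExtension X W C =
  NeighbourTransitive2 X C
  × C zeroV
  × (∀ w → W w → X (transl w))
  × (∀ g → InK X g → Stabilises g W)

StabW : ∀ {m} → (Aut m → Set) → Code m → Aut m → Set
StabW X W g = X g × Stabilises g W

Fix2 : ∀ {m} → (Aut m → Set) → Fin m → Fin m → Aut m → Set
Fix2 X i j g = X g × perm g ⟨$⟩ʳ i ≡ i × perm g ⟨$⟩ʳ j ≡ j

InducedBy : ∀ {m} → (Aut m → Set) → Permutation′ m → Set
InducedBy Y π = ∃ λ g → Y g × perm g P.≈ π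

TwoTransitive : ∀ {m} → (Permutation′ m → Set) → Set
TwoTransitive {m} G = ∀ (i j k l : Fin m) → i ≢ j → k ≢ l →
  ∃ λ π → G π × π ⟨$⟩ʳ i ≡ k × π ⟨$⟩ʳ j ≡ l

TwoHomogeneous : ∀ {m} → (Permutation′ m → Set) → Set
TwoHomogeneous {m} G = ∀ (i j k l : Fin m) → i ≢ j → k ≢ l →
  ∃ λ π → G π × ((π ⟨$⟩ʳ i ≡ k × π ⟨$⟩ʳ j ≡ l) ⊎ (π ⟨$⟩ʳ i ≡ l × π ⟨$⟩ʳ j ≡ k))

-- N is a normal subgroup of index 2 of the permutation group G
-- (group product on perms: π then ρ is  π ∘ₚ ρ).
record NormalIndex2 {m} (G N : Permutation′ m → Set) : Set where
  field
    resp    : ∀ {π ρ} → π P.≈ ρ → N π → N ρ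
    sub     : ∀ {π} → N π → G π
    hasId   : N P.id
    mul     : ∀ {π ρ} → N π → N ρ → N (π ∘ₚ ρ)
    inv     : ∀ {π} → N π → N (P.flip π)
    normal  : ∀ {g π} → G g → N π → N (P.flip g ∘ₚ (π ∘ₚ g))
    outside : ∃ λ a → G a × ¬ N a
    cosets  : ∀ a → G a → ¬ N a → ∀ g → G g → N g ⊎ N (g ∘ₚ P.flip a)

HasNormalIndex2 : ∀ {m} → (Permutation′ m → Set) → Set₁
HasNormalIndex2 {m} G = ∃ λ (N : Permutation′ m → Set) → NormalIndex2 G N

module Submission where

-- Since δ ≥ 5, the weight-2 vectors lie in C₂ and two codewords at distance
-- at most 4 coincide.  An element of X carrying one weight-2 vector to
-- another fixes 0, so it has zero shift (it lies in X_W) and maps the two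
-- supports onto each other: this gives 2-homogeneity of X_W^M.  If δ = m then
-- C = W, so a non-trivial C contains a codeword taking both values.
-- Translating 0 to it and correcting by a zero-shift element yields an
-- element of X that either interchanges two entries k, l, or fixes them
-- while its shift differs at k and l.  The "parity" (shift at k xor shift
-- at l) of the powers of such an element alternates, while a power acting
-- trivially on M lies in K = K_W and so has even parity; a suitable power
-- therefore acts as an element interchanging two entries.  A 2-homogeneous
-- group containing such an element is 2-transitive.  Finally, when X_W^M is
-- 2-transitive the same construction gives elements of X_{i,j} of both
-- parities, and the permutations induced by even elements form a normal
-- subgroup of index 2 of X_{i,j}^M; parity is well defined on X_{i,j}^M
-- because elements of K have constant shift.

open import Defs
open import Data.Nat using (ℕ; zero; suc; _+_; _*_; _∸_; _≤_; _<_; z≤n; s≤s; _!)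
open import Data.Nat.Properties
open import Data.Nat.Divisibility using (divides; ∣-trans; m∣m*n; m≤n⇒m!∣n!)
open import Data.Nat.Induction using (<-rec)
open import Data.Bool using (Bool; true; false; not; _xor_; _∨_; if_then_else_)
open import Data.Bool.Properties using (xor-same; xor-comm; xor-identityʳ; true-xor; ¬-not; xor-∧-commutativeRing)
import Data.Bool.Properties as Bool
open import Data.Fin using (Fin; zero; suc; toℕ)
import Data.Fin.Properties as Fin
open import Data.Vec using ([]; _∷_; lookup; replicate; zipWith)
open import Data.Vec.Properties using (lookup∘tabulate; tabulate∘lookup; tabulate-cong; lookup-replicate; lookup-zipWith; ≡-dec)
open import Data.Fin.Permutation as P using (Permutation′; _⟨$⟩ʳ_; _⟨$⟩ˡ_; _∘ₚ_)
open import Data.Product using (∃; _×_; _,_; proj₁; proj₂; map₁; map₂)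
open import Data.Sum using (_⊎_; inj₁; inj₂)
open import Data.Empty using (⊥-elim)
open import Relation.Nullary using (¬_; yes; no)
open import Relation.Binary.PropositionalEquality
open import Algebra.Bundles using (CommutativeRing)
import Algebra.Properties.CommutativeSemigroup as CommSemigroupProperties
open import Algebra.Properties.CommutativeMonoid.Sum +-0-commutativeMonoid using (sum; sum-cong-≗; sum-permute)

open ≡-Reasoning

xor-interchange : ∀ a b c d → (a xor c) xor (b xor d) ≡ (a xor b) xor (c xor d)
xor-interchange a b c d = interchange a c b d
  where
  open CommSemigroupProperties (CommutativeRing.+-commutativeSemigroup xor-∧-commutativeRing)

xor≡false⇒≡ : ∀ {a b} → a xor b ≡ false → a ≡ b
xor≡false⇒≡ {false} {false} _ = refl
xor≡false⇒≡ {true}  {true}  _ = refl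

bit : Bool → ℕ
bit b = if b then 1 else 0

dist-as-sum : ∀ {m} (α β : Vertex m) → dist α β ≡ sum (λ i → bit (lookup α i xor lookup β i))
dist-as-sum []      []      = refl
dist-as-sum (x ∷ α) (y ∷ β) = cong (bit (x xor y) +_) (dist-as-sum α β)

dist-sym : ∀ {m} (α β : Vertex m) → dist α β ≡ dist β α
dist-sym []      []      = refl
dist-sym (x ∷ α) (y ∷ β) = cong₂ _+_ (cong bit (xor-comm x y)) (dist-sym α β)

bit-triangle : ∀ x y z → bit (x xor z) ≤ bit (x xor y) + bit (y xor z)
bit-triangle false false z     = ≤-refl
bit-triangle false true  false = z≤n
bit-triangle false true  true  = s≤s z≤n
bit-triangle true  false false = s≤s z≤n
bit-triangle true  false true  = z≤n
bit-triangle true  true  z     = m≤n+m _ 0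

dist-triangle : ∀ {m} (α β γ : Vertex m) → dist α γ ≤ dist α β + dist β γ
dist-triangle []      []      []      = z≤n
dist-triangle (x ∷ α) (y ∷ β) (z ∷ γ) =
  ≤-trans (+-mono-≤ (bit-triangle x y z) (dist-triangle α β γ))
          (≤-reflexive (interchange (bit (x xor y)) (bit (y xor z)) (dist α β) (dist β γ)))
  where open CommSemigroupProperties +-commutativeSemigroup using (interchange)

dist-self : ∀ {m} (α : Vertex m) → dist α α ≡ 0
dist-self []      = refl
dist-self (x ∷ α) rewrite xor-same x = dist-self α

dist-≤-length : ∀ {m} (α β : Vertex m) → dist α β ≤ m
dist-≤-length []      []      = z≤n
dist-≤-length (x ∷ α) (y ∷ β) with x xor y
... | true  = s≤s (dist-≤-length α β)
... | false = m≤n⇒m≤1+n (dist-≤-length α β)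

dist-0-1 : ∀ {m} → dist (zeroV {m}) oneV ≡ m
dist-0-1 {zero}  = refl
dist-0-1 {suc m} = cong suc (dist-0-1 {m})

full-weight⇒1 : ∀ {m} (v : Vertex m) → m ≤ dist zeroV v → v ≡ oneV
full-weight⇒1 []           _       = refl
full-weight⇒1 (true  ∷ v) (s≤s w) = cong (true ∷_) (full-weight⇒1 v w)
full-weight⇒1 (false ∷ v) w       = ⊥-elim (<⇒≱ (s≤s (dist-≤-length zeroV v)) w)

vec-ext : ∀ {m} {u v : Vertex m} → (∀ i → lookup u i ≡ lookup v i) → u ≡ v
vec-ext {u = u} {v} u≗v = trans (sym (tabulate∘lookup u)) (trans (tabulate-cong u≗v) (tabulate∘lookup v))

parityAt : ∀ {m} → Fin m → Fin m → Vertex m → Bool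
parityAt i j v = lookup v i xor lookup v j

non-constant : ∀ {m} {v : Vertex m} → v ≢ zeroV → v ≢ oneV →
  ∃ λ k → ∃ λ l → parityAt k l v ≡ true
non-constant {m} {v} v≢0 v≢1 with Fin.any? (λ k → lookup v k Bool.≟ true)
                              | Fin.any? (λ l → lookup v l Bool.≟ false)
... | yes (k , vk) | yes (l , vl) = k , l , cong₂ _xor_ vk vl
... | no no-true   | _            =
  ⊥-elim (v≢0 (vec-ext λ x → trans (¬-not λ vx → no-true (x , vx)) (sym (lookup-replicate x false))))
... | _            | no no-false  =
  ⊥-elim (v≢1 (vec-ext λ x → trans (¬-not λ vx → no-false (x , vx)) (sym (lookup-replicate x true))))

⟨$⟩ˡ-of : ∀ {m} (π : Permutation′ m) {a b} → π ⟨$⟩ʳ a ≡ b → π ⟨$⟩ˡ b ≡ a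
⟨$⟩ˡ-of π {a} πa≡b = trans (cong (π ⟨$⟩ˡ_) (sym πa≡b)) (P.inverseˡ π)

⟨$⟩ʳ-injective : ∀ {m} (π : Permutation′ m) {a b} → π ⟨$⟩ʳ a ≡ π ⟨$⟩ʳ b → a ≡ b
⟨$⟩ʳ-injective π {a} πa≡πb = trans (sym (⟨$⟩ˡ-of π πa≡πb)) (P.inverseˡ π)

⟨$⟩ˡ-injective : ∀ {m} (π : Permutation′ m) {a b} → π ⟨$⟩ˡ a ≡ π ⟨$⟩ˡ b → a ≡ b
⟨$⟩ˡ-injective π = ⟨$⟩ʳ-injective (P.flip π)

flip-cong : ∀ {m} (π ρ : Permutation′ m) → π P.≈ ρ → P.flip π P.≈ P.flip ρ
flip-cong π ρ π≈ρ x = sym (⟨$⟩ˡ-of ρ (trans (sym (π≈ρ (π ⟨$⟩ˡ x))) (P.inverseʳ π)))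

Sends : ∀ {m} → Permutation′ m → Fin m → Fin m → Fin m → Fin m → Set
Sends π i j k l = π ⟨$⟩ʳ i ≡ k × π ⟨$⟩ʳ j ≡ l

SendsPair : ∀ {m} → Permutation′ m → Fin m → Fin m → Fin m → Fin m → Set
SendsPair π i j k l = Sends π i j k l ⊎ Sends π i j l k

onto-pair : ∀ {m} (π : Permutation′ m) {i j k l} → i ≢ j →
  (π ⟨$⟩ʳ i ≡ k ⊎ π ⟨$⟩ʳ i ≡ l) → (π ⟨$⟩ʳ j ≡ k ⊎ π ⟨$⟩ʳ j ≡ l) →
  SendsPair π i j k l
onto-pair π i≢j (inj₁ πi) (inj₂ πj) = inj₁ (πi , πj)
onto-pair π i≢j (inj₂ πi) (inj₁ πj) = inj₂ (πi , πj)
onto-pair π i≢j (inj₁ πi) (inj₁ πj) = ⊥-elim (i≢j (⟨$⟩ʳ-injective π (trans πi (sym πj))))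
onto-pair π i≢j (inj₂ πi) (inj₂ πj) = ⊥-elim (i≢j (⟨$⟩ʳ-injective π (trans πi (sym πj))))

lookup-act : ∀ {m} (g : Aut m) α y → lookup (act g α) y ≡ lookup α (perm g ⟨$⟩ˡ y) xor lookup (shift g) y
lookup-act g α = lookup∘tabulate _

lookup-act-image : ∀ {m} (g : Aut m) α x →
  lookup (act g α) (perm g ⟨$⟩ʳ x) ≡ lookup α x xor lookup (shift g) (perm g ⟨$⟩ʳ x)
lookup-act-image g α x =
  trans (lookup-act g α (perm g ⟨$⟩ʳ x))
        (cong (λ y → lookup α y xor lookup (shift g) (perm g ⟨$⟩ʳ x)) (P.inverseˡ (perm g)))

act-zero : ∀ {m} (g : Aut m) → act g zeroV ≡ shift g
act-zero g = vec-ext λ y → trans (lookup-act g zeroV y)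
  (cong (_xor lookup (shift g) y) (lookup-replicate (perm g ⟨$⟩ˡ y) false))

lookup-shift-· : ∀ {m} (g h : Aut m) y →
  lookup (shift (g · h)) y ≡ lookup (shift h) (perm g ⟨$⟩ˡ y) xor lookup (shift g) y
lookup-shift-· g h = lookup∘tabulate _

·-sends : ∀ {m} (g h : Aut m) {x y} → perm h ⟨$⟩ʳ x ≡ perm g ⟨$⟩ˡ y → perm (g · h) ⟨$⟩ʳ x ≡ y
·-sends g h hx = trans (cong (perm g ⟨$⟩ʳ_) hx) (P.inverseʳ (perm g))

dist-act : ∀ {m} (g : Aut m) α β → dist (act g α) (act g β) ≡ dist α β
dist-act {m} g α β = begin
  dist (act g α) (act g β)
    ≡⟨ dist-as-sum (act g α) (act g β) ⟩
  sum (λ y → bit (lookup (act g α) y xor lookup (act g β) y))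
    ≡⟨ sum-cong-≗ (λ y → cong bit (differs y)) ⟩
  sum (λ y → differ (perm g ⟨$⟩ˡ y))
    ≡⟨ sum-permute differ (P.flip (perm g)) ⟨
  sum differ
    ≡⟨ dist-as-sum α β ⟨
  dist α β ∎
  where
  differ : Fin m → ℕ
  differ x = bit (lookup α x xor lookup β x)
  differs : ∀ y → lookup (act g α) y xor lookup (act g β) y
                ≡ lookup α (perm g ⟨$⟩ˡ y) xor lookup β (perm g ⟨$⟩ˡ y)
  differs y = begin
    lookup (act g α) y xor lookup (act g β) y  ≡⟨ cong₂ _xor_ (lookup-act g α y) (lookup-act g β y) ⟩
    (a xor s) xor (b xor s)                    ≡⟨ xor-interchange a b s s ⟩
    (a xor b) xor (s xor s)                    ≡⟨ cong ((a xor b) xor_) (xor-same s) ⟩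
    (a xor b) xor false                        ≡⟨ xor-identityʳ (a xor b) ⟩
    a xor b                                    ∎
    where
    a : Bool
    a = lookup α (perm g ⟨$⟩ˡ y)
    b : Bool
    b = lookup β (perm g ⟨$⟩ˡ y)
    s : Bool
    s = lookup (shift g) y

Rep-constant : ∀ {m} {v : Vertex m} → Rep v → ∀ a b → lookup v a ≡ lookup v b
Rep-constant (inj₁ refl) a b = trans (lookup-replicate a false) (sym (lookup-replicate b false))
Rep-constant (inj₂ refl) a b = trans (lookup-replicate a true) (sym (lookup-replicate b true))

shift-of-stabiliser : ∀ {m} (h : Aut m) → Stabilises h Rep → Rep (shift h)
shift-of-stabiliser h h-stab = subst Rep (act-zero h) (proj₁ (h-stab zeroV) (inj₁ refl))

module ZeroShift {m} (g : Aut m) (g0 : shift g ≡ zeroV) where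

  permutes : ∀ α x → lookup (act g α) (perm g ⟨$⟩ʳ x) ≡ lookup α x
  permutes α x = begin
    lookup (act g α) (perm g ⟨$⟩ʳ x)                       ≡⟨ lookup-act-image g α x ⟩
    lookup α x xor lookup (shift g) (perm g ⟨$⟩ʳ x)        ≡⟨ cong (λ s → lookup α x xor lookup s (perm g ⟨$⟩ʳ x)) g0 ⟩
    lookup α x xor lookup (replicate m false) (perm g ⟨$⟩ʳ x)
      ≡⟨ cong (lookup α x xor_) (lookup-replicate (perm g ⟨$⟩ʳ x) false) ⟩
    lookup α x xor false                                    ≡⟨ xor-identityʳ (lookup α x) ⟩
    lookup α x                                              ∎

  fixes-constant : ∀ b → act g (replicate m b) ≡ replicate m b
  fixes-constant b = vec-ext λ y → begin
    lookup (act g (replicate m b)) y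
      ≡⟨ lookup-act g (replicate m b) y ⟩
    lookup (replicate m b) (perm g ⟨$⟩ˡ y) xor lookup (shift g) y
      ≡⟨ cong₂ (λ a s → a xor lookup s y) (lookup-replicate (perm g ⟨$⟩ˡ y) b) g0 ⟩
    b xor lookup (replicate m false) y
      ≡⟨ cong (b xor_) (lookup-replicate y false) ⟩
    b xor false
      ≡⟨ xor-identityʳ b ⟩
    b
      ≡⟨ lookup-replicate y b ⟨
    lookup (replicate m b) y ∎

  only-constant : ∀ {α} b → act g α ≡ replicate m b → α ≡ replicate m b
  only-constant {α} b gα≡b = vec-ext λ x → begin
    lookup α x                              ≡⟨ permutes α x ⟨
    lookup (act g α) (perm g ⟨$⟩ʳ x)        ≡⟨ cong (λ v → lookup v (perm g ⟨$⟩ʳ x)) gα≡b ⟩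
    lookup (replicate m b) (perm g ⟨$⟩ʳ x)  ≡⟨ lookup-replicate (perm g ⟨$⟩ʳ x) b ⟩
    b                                       ≡⟨ lookup-replicate x b ⟨
    lookup (replicate m b) x                ∎

  stabilises-W : Stabilises g Rep
  stabilises-W α = forward , backward
    where
    forward : Rep α → Rep (act g α)
    forward (inj₁ refl) = inj₁ (fixes-constant false)
    forward (inj₂ refl) = inj₂ (fixes-constant true)
    backward : Rep (act g α) → Rep α
    backward (inj₁ gα≡0) = inj₁ (only-constant false gα≡0)
    backward (inj₂ gα≡1) = inj₂ (only-constant true gα≡1)

unit : ∀ {m} → Fin m → Vertex m
unit zero    = true ∷ zeroV
unit (suc i) = false ∷ unit i

pairVec : ∀ {m} → Fin m → Fin m → Vertex m
pairVec i j = zipWith _∨_ (unit i) (unit j)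

unit-weight : ∀ {m} (i : Fin m) → dist zeroV (unit i) ≡ 1
unit-weight {suc m} zero = cong suc (dist-self (zeroV {m}))
unit-weight (suc i)      = unit-weight i

∨-zeroˡ-vec : ∀ {n} (v : Vertex n) → zipWith _∨_ zeroV v ≡ v
∨-zeroˡ-vec []      = refl
∨-zeroˡ-vec (x ∷ v) = cong (x ∷_) (∨-zeroˡ-vec v)

∨-zeroʳ-vec : ∀ {n} (v : Vertex n) → zipWith _∨_ v zeroV ≡ v
∨-zeroʳ-vec []      = refl
∨-zeroʳ-vec (x ∷ v) = cong₂ _∷_ (Bool.∨-identityʳ x) (∨-zeroʳ-vec v)

pairVec-weight : ∀ {m} {i j : Fin m} → i ≢ j → dist zeroV (pairVec i j) ≡ 2
pairVec-weight {i = zero}  {zero}  i≢j = ⊥-elim (i≢j refl)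
pairVec-weight {i = zero}  {suc j} _   = cong suc (trans (cong (dist zeroV) (∨-zeroˡ-vec (unit j))) (unit-weight j))
pairVec-weight {i = suc i} {zero}  _   = cong suc (trans (cong (dist zeroV) (∨-zeroʳ-vec (unit i))) (unit-weight i))
pairVec-weight {i = suc i} {suc j} i≢j = pairVec-weight (λ i≡j → i≢j (cong suc i≡j))

unit-support : ∀ {m} (i x : Fin m) → lookup (unit i) x ≡ true → x ≡ i
unit-support zero    zero    _  = refl
unit-support zero    (suc x) ux = ⊥-elim (Bool.not-¬ (lookup-replicate x false) ux)
unit-support (suc i) (suc x) ux = cong suc (unit-support i x ux)

unit-self : ∀ {m} (i : Fin m) → lookup (unit i) i ≡ true
unit-self zero    = refl
unit-self (suc i) = unit-self i

pairVec-support : ∀ {m} (i j x : Fin m) → lookup (pairVec i j) x ≡ true → x ≡ i ⊎ x ≡ j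
pairVec-support i j x ux with lookup (unit i) x in ui | lookup (unit j) x in uj
... | true  | _     = inj₁ (unit-support i x ui)
... | false | true  = inj₂ (unit-support j x uj)
... | false | false = ⊥-elim (Bool.not-¬ (trans (lookup-zipWith _∨_ x (unit i) (unit j)) (cong₂ _∨_ ui uj)) ux)

pairVec-left : ∀ {m} (i j : Fin m) → lookup (pairVec i j) i ≡ true
pairVec-left i j = trans (lookup-zipWith _∨_ i (unit i) (unit j)) (cong (_∨ lookup (unit j) i) (unit-self i))

pairVec-right : ∀ {m} (i j : Fin m) → lookup (pairVec i j) j ≡ true
pairVec-right i j = trans (lookup-zipWith _∨_ j (unit i) (unit j))
  (trans (cong (lookup (unit i) j ∨_) (unit-self j)) (Bool.∨-zeroʳ (lookup (unit i) j)))

parity : ∀ {m} → Fin m → Fin m → Aut m → Bool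
parity i j g = parityAt i j (shift g)

odd⇒distinct : ∀ {m} (v : Vertex m) {i j} → parityAt i j v ≡ true → i ≢ j
odd⇒distinct v {i} odd refl = Bool.not-¬ (xor-same (lookup v i)) odd

Rep-parity : ∀ {m} {v : Vertex m} → Rep v → ∀ a b → parityAt a b v ≡ false
Rep-parity {v = v} rep a b = trans (cong (_xor _) (Rep-constant rep a b)) (xor-same (lookup v b))

parity-· : ∀ {m} (g h : Aut m) {i j a b} → perm g ⟨$⟩ˡ i ≡ a → perm g ⟨$⟩ˡ j ≡ b →
  parity i j (g · h) ≡ parity a b h xor parity i j g
parity-· g h {i} {j} {a} {b} refl refl =
  trans (cong₂ _xor_ (lookup-shift-· g h i) (lookup-shift-· g h j))
        (xor-interchange (lookup (shift h) a) (lookup (shift h) b) (lookup (shift g) i) (lookup (shift g) j))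

parity-inv : ∀ {m} (g : Aut m) {i j} → perm g ⟨$⟩ʳ i ≡ i → perm g ⟨$⟩ʳ j ≡ j →
  parity i j (invA g) ≡ parity i j g
parity-inv g {i} {j} gi gj = cong₂ _xor_
  (trans (lookup∘tabulate _ i) (cong (lookup (shift g)) gi))
  (trans (lookup∘tabulate _ j) (cong (lookup (shift g)) gj))

parity-act : ∀ {m} (h : Aut m) → Rep (shift h) → ∀ α k l →
  parityAt (perm h ⟨$⟩ʳ k) (perm h ⟨$⟩ʳ l) (act h α) ≡ parityAt k l α
parity-act {m} h rep α k l = begin
  parityAt (perm h ⟨$⟩ʳ k) (perm h ⟨$⟩ʳ l) (act h α)
    ≡⟨ cong₂ _xor_ (lookup-act-image h α k) (lookup-act-image h α l) ⟩
  (lookup α k xor lookup (shift h) k′) xor (lookup α l xor lookup (shift h) l′)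
    ≡⟨ xor-interchange (lookup α k) (lookup α l) (lookup (shift h) k′) (lookup (shift h) l′) ⟩
  parityAt k l α xor parityAt k′ l′ (shift h)
    ≡⟨ cong (parityAt k l α xor_) (Rep-parity rep k′ l′) ⟩
  parityAt k l α xor false
    ≡⟨ xor-identityʳ _ ⟩
  parityAt k l α ∎
  where
  k′ : Fin m
  k′ = perm h ⟨$⟩ʳ k
  l′ : Fin m
  l′ = perm h ⟨$⟩ʳ l

_^_ : ∀ {m} → Permutation′ m → ℕ → Fin m → Fin m
(σ ^ zero)  x = x
(σ ^ suc n) x = σ ⟨$⟩ʳ (σ ^ n) x

Trivial : ∀ {m} → Permutation′ m → ℕ → Set
Trivial σ n = ∀ x → (σ ^ n) x ≡ x

^-+ : ∀ {m} (σ : Permutation′ m) a b x → (σ ^ (a + b)) x ≡ (σ ^ a) ((σ ^ b) x)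
^-+ σ zero    b x = refl
^-+ σ (suc a) b x = cong (σ ⟨$⟩ʳ_) (^-+ σ a b x)

^-injective : ∀ {m} (σ : Permutation′ m) a {x y} → (σ ^ a) x ≡ (σ ^ a) y → x ≡ y
^-injective σ zero    e = e
^-injective σ (suc a) e = ^-injective σ a (⟨$⟩ʳ-injective σ e)

^-multiple : ∀ {m} (σ : Permutation′ m) q {k} x → (σ ^ k) x ≡ x → (σ ^ (q * k)) x ≡ x
^-multiple σ zero    x _     = refl
^-multiple σ (suc q) {k} x σᵏx = trans (^-+ σ k (q * k) x) (trans (cong (σ ^ k) (^-multiple σ q x σᵏx)) σᵏx)

^-returns : ∀ {m} (σ : Permutation′ m) x → ∃ λ k → 1 ≤ k × k ≤ m × (σ ^ k) x ≡ x
^-returns {m} σ x with Fin.pigeonhole (n<1+n m) (λ t → (σ ^ toℕ t) x)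
... | a , b , a<b , σᵃx≡σᵇx = toℕ b ∸ toℕ a , m<n⇒0<n∸m a<b , ≤m , returns
  where
  ≤m : toℕ b ∸ toℕ a ≤ m
  ≤m = ≤-trans (m∸n≤m (toℕ b) (toℕ a)) (≤-pred (Fin.toℕ<n b))
  returns : (σ ^ (toℕ b ∸ toℕ a)) x ≡ x
  returns = ^-injective σ (toℕ a) (sym (begin
    (σ ^ toℕ a) x                              ≡⟨ σᵃx≡σᵇx ⟩
    (σ ^ toℕ b) x                              ≡⟨ cong (λ n → (σ ^ n) x) (m+[n∸m]≡n (<⇒≤ a<b)) ⟨
    (σ ^ (toℕ a + (toℕ b ∸ toℕ a))) x          ≡⟨ ^-+ σ (toℕ a) _ x ⟩
    (σ ^ toℕ a) ((σ ^ (toℕ b ∸ toℕ a)) x)      ∎))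

^-factorial : ∀ {m} (σ : Permutation′ m) → Trivial σ (m !)
^-factorial {m} σ x with ^-returns σ x
... | suc k , _ , k≤m , σᵏx with ∣-trans (m∣m*n {suc k} (k !)) (m≤n⇒m!∣n! k≤m)
...   | divides q m!≡q*k = subst (λ n → (σ ^ n) x ≡ x) (sym m!≡q*k) (^-multiple σ q x σᵏx)

Even : ℕ → Set
Even n = ∃ λ r → n ≡ r + r

alternating⇒even : (p : ℕ → Bool) → p 0 ≡ false → (∀ n → p (suc n) ≡ not (p n)) →
  ∀ n → p n ≡ false → Even n
alternating⇒even p p0 alt zero          _  = 0 , refl
alternating⇒even p p0 alt (suc zero)    p1 = ⊥-elim (Bool.not-¬ (trans (alt 0) (cong not p0)) p1)
alternating⇒even p p0 alt (suc (suc n)) pn+2 =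
  let (r , n≡r+r) = alternating⇒even p p0 alt n pn
  in  suc r , cong suc (trans (cong suc n≡r+r) (sym (+-suc r r)))
  where
  pn : p n ≡ false
  pn = trans (sym (Bool.not-involutive (p n)))
             (trans (cong not (sym (alt n))) (trans (sym (alt (suc n))) pn+2))

-- If every trivial power of σ has even exponent, some power σʳ is
-- non-trivial while σ²ʳ is trivial; so σʳ interchanges some x and σʳx.
involutive-power : ∀ {m} (σ : Permutation′ m) → (∀ n → Trivial σ n → Even n) →
  ∃ λ x → ∃ λ r → (σ ^ r) x ≢ x × (σ ^ r) ((σ ^ r) x) ≡ x
involutive-power {m} σ even-orders = <-rec Goal halve (m !) (1≤n! m) (^-factorial σ)
  where
  Goal : ℕ → Set
  Goal n = 1 ≤ n → Trivial σ n → ∃ λ x → ∃ λ r → (σ ^ r) x ≢ x × (σ ^ r) ((σ ^ r) x) ≡ x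
  halve : ∀ n → (∀ {k} → k < n → Goal k) → Goal n
  halve n smaller 1≤n σⁿ with even-orders n σⁿ
  ... | zero  , refl = ⊥-elim (n≮0 1≤n)
  ... | suc r , refl with Fin.all? (λ x → (σ ^ suc r) x Fin.≟ x)
  ...   | yes σʳ = smaller (m<m+n (suc r) (s≤s z≤n)) (s≤s z≤n) σʳ
  ...   | no ¬σʳ with Fin.¬∀⟶∃¬ m _ (λ x → (σ ^ suc r) x Fin.≟ x) ¬σʳ
  ...     | x , moved = x , suc r , moved , trans (sym (^-+ σ (suc r) (suc r) x)) (σⁿ x)

homogeneous-with-interchange⇒2-transitive : ∀ {m} {G : Permutation′ m → Set} →
  (∀ {π ρ} → G π → G ρ → G (π ∘ₚ ρ)) → TwoHomogeneous G →
  ∀ {x y} s → x ≢ y → G s → Sends s x y y x → TwoTransitive G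
homogeneous-with-interchange⇒2-transitive {G = G} closed homogeneous {x} {y} s x≢y Gs (sx , sy)
  i j k l i≢j k≢l =
  let (ρ , Gρ , ρi , ρj) = to-xy i j i≢j
      (π , Gπ , πx , πy) = from-xy k l k≢l
  in  ρ ∘ₚ π , closed Gρ Gπ , trans (cong (π ⟨$⟩ʳ_) ρi) πx , trans (cong (π ⟨$⟩ʳ_) ρj) πy
  where
  -- any ordered pair can be sent to (x, y), composing with s if necessary

  to-xy : ∀ a b → a ≢ b → ∃ λ π → G π × Sends π a b x y
  to-xy a b a≢b with homogeneous a b x y a≢b x≢y
  ... | π , Gπ , inj₁ sends     = π , Gπ , sends
  ... | π , Gπ , inj₂ (πa , πb) =
    π ∘ₚ s , closed Gπ Gs , trans (cong (s ⟨$⟩ʳ_) πa) sy , trans (cong (s ⟨$⟩ʳ_) πb) sx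
  from-xy : ∀ c d → c ≢ d → ∃ λ π → G π × Sends π x y c d
  from-xy c d c≢d with homogeneous x y c d x≢y c≢d
  ... | π , Gπ , inj₁ sends     = π , Gπ , sends
  ... | π , Gπ , inj₂ (πx , πy) =
    s ∘ₚ π , closed Gs Gπ , trans (cong (π ⟨$⟩ʳ_) sx) πy , trans (cong (π ⟨$⟩ʳ_) sy) πx

2-homogeneous-mono : ∀ {m} {G H : Permutation′ m → Set} → (∀ {π} → G π → H π) →
  TwoHomogeneous G → TwoHomogeneous H
2-homogeneous-mono G⊆H homogeneous i j k l i≢j k≢l =
  map₂ (map₁ G⊆H) (homogeneous i j k l i≢j k≢l)

induced-∘ : ∀ {m} {X : Aut m → Set} → IsSubgroup X →
  ∀ {π ρ} → InducedBy X π → InducedBy X ρ → InducedBy X (π ∘ₚ ρ)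
induced-∘ X-subgroup (g , Xg , g≈π) (h , Xh , h≈ρ) =
  h · g , IsSubgroup.mul X-subgroup Xh Xg , λ x → trans (cong (perm h ⟨$⟩ʳ_) (g≈π x)) (h≈ρ _)

module NeighbourTransitiveExtension
  {m : ℕ} {X : Aut m → Set} {C : Code m}
  (X-subgroup : IsSubgroup X) (C-extension : IsExtension X Rep C)
  {δ : ℕ} (δ-minimum : IsMinDist C δ) (5≤δ : 5 ≤ δ) where

  open IsSubgroup X-subgroup

  X-preserves-C : ∀ {g} → X g → ∀ {α} → C α → C (act g α)
  X-preserves-C Xg {α} = proj₁ (proj₁ (proj₁ C-extension) _ Xg α)

  X-transitive-on-C : TransitiveOn X C
  X-transitive-on-C = proj₁ (proj₂ (proj₁ C-extension))

  X-transitive-on-C₂ : TransitiveOn X (Nbhd C 2)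
  X-transitive-on-C₂ = proj₂ (proj₂ (proj₂ (proj₁ C-extension)))

  0∈C : C zeroV
  0∈C = proj₁ (proj₂ C-extension)

  T_W≤X : ∀ w → Rep w → X (transl w)
  T_W≤X = proj₁ (proj₂ (proj₂ C-extension))

  K-stabilises-W : ∀ g → InK X g → Stabilises g Rep
  K-stabilises-W = proj₂ (proj₂ (proj₂ C-extension))

  -- Elements of K have constant shift, so even parity everywhere.
  K-parity : ∀ {g} → X g → perm g P.≈ P.id → ∀ a b → parity a b g ≡ false
  K-parity {g} Xg trivial = Rep-parity (shift-of-stabiliser g (K-stabilises-W g (Xg , trivial)))

  1∈C : C oneV
  1∈C = subst C (act-zero (transl oneV)) (X-preserves-C (T_W≤X oneV (inj₂ refl)) 0∈C)

  translate-to : ∀ {c} → C c → ∃ λ g → X g × shift g ≡ c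
  translate-to Cc with X-transitive-on-C zeroV _ 0∈C Cc
  ... | g , Xg , g0≡c = g , Xg , trans (sym (act-zero g)) g0≡c

  close-codewords-equal : ∀ {c c′} → C c → C c′ → dist c c′ ≤ 4 → c ≡ c′
  close-codewords-equal {c} {c′} Cc Cc′ close with ≡-dec Bool._≟_ c c′
  ... | yes c≡c′ = c≡c′
  ... | no  c≢c′ = ⊥-elim (<⇒≱ (s≤s close) (≤-trans 5≤δ (proj₂ δ-minimum c c′ Cc Cc′ c≢c′)))

  -- Weight-two vectors lie in C₂: 0 is at distance 2, and a codeword at
  -- distance at most 1 would be within 3 of 0, hence equal to 0.
  pairVec-in-C₂ : ∀ {i j} → i ≢ j → Nbhd C 2 (pairVec i j)
  pairVec-in-C₂ {i} {j} i≢j = (zeroV , 0∈C , u-to-0) , at-least-2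
    where
    u : Vertex m
    u = pairVec i j
    u-to-0 : dist u zeroV ≡ 2
    u-to-0 = trans (dist-sym u zeroV) (pairVec-weight i≢j)
    at-least-2 : ∀ c → C c → 2 ≤ dist u c
    at-least-2 c Cc = ≮⇒≥ λ d<2 → <-irrefl u-to-0 (subst (λ v → dist u v < 2) (c≡0 d<2) d<2)
      where
      c≡0 : dist u c < 2 → c ≡ zeroV
      c≡0 d<2 = sym (close-codewords-equal 0∈C Cc (≤-trans (dist-triangle zeroV u c)
        (≤-trans (+-mono-≤ (≤-reflexive (pairVec-weight i≢j)) (≤-pred d<2)) (n≤1+n 3))))

  pairs-moved : ∀ {i j k l} → i ≢ j → k ≢ l →
    ∃ λ g → X g × shift g ≡ zeroV × SendsPair (perm g) i j k l
  pairs-moved {i} {j} {k} {l} i≢j k≢l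
    with X-transitive-on-C₂ (pairVec i j) (pairVec k l) (pairVec-in-C₂ i≢j) (pairVec-in-C₂ k≢l)
  ... | g , Xg , gu≡v =
    g , Xg , g0 , onto-pair (perm g) i≢j (lands i (pairVec-left i j)) (lands j (pairVec-right i j))
    where
    -- g0 is a codeword at distance 2 from gu = v, hence within 4 of 0.
    v-to-g0 : dist (pairVec k l) (act g zeroV) ≡ 2
    v-to-g0 = begin
      dist (pairVec k l) (act g zeroV)          ≡⟨ cong (λ v → dist v (act g zeroV)) (sym gu≡v) ⟩
      dist (act g (pairVec i j)) (act g zeroV)  ≡⟨ dist-act g (pairVec i j) zeroV ⟩
      dist (pairVec i j) zeroV                  ≡⟨ dist-sym (pairVec i j) zeroV ⟩
      dist zeroV (pairVec i j)                  ≡⟨ pairVec-weight i≢j ⟩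
      2                                         ∎
    g0-close : dist zeroV (act g zeroV) ≤ 4
    g0-close = ≤-trans (dist-triangle zeroV (pairVec k l) (act g zeroV))
                       (≤-reflexive (cong₂ _+_ (pairVec-weight k≢l) v-to-g0))
    g0 : shift g ≡ zeroV
    g0 = trans (sym (act-zero g)) (sym (close-codewords-equal 0∈C (X-preserves-C Xg 0∈C) g0-close))
    -- g has zero shift, so it carries the support of u into that of v.
    lands : ∀ x → lookup (pairVec i j) x ≡ true → perm g ⟨$⟩ʳ x ≡ k ⊎ perm g ⟨$⟩ʳ x ≡ l
    lands x ux = pairVec-support k l (perm g ⟨$⟩ʳ x) (begin
      lookup (pairVec k l) (perm g ⟨$⟩ʳ x)           ≡⟨ cong (λ v → lookup v (perm g ⟨$⟩ʳ x)) (sym gu≡v) ⟩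
      lookup (act g (pairVec i j)) (perm g ⟨$⟩ʳ x)   ≡⟨ ZeroShift.permutes g g0 (pairVec i j) x ⟩
      lookup (pairVec i j) x                         ≡⟨ ux ⟩
      true                                           ∎)

  X_W-2-homogeneous : TwoHomogeneous (InducedBy (StabW X Rep))
  X_W-2-homogeneous i j k l i≢j k≢l = induced (pairs-moved i≢j k≢l)
    where
    induced : (∃ λ g → X g × shift g ≡ zeroV × SendsPair (perm g) i j k l) →
      ∃ λ π → InducedBy (StabW X Rep) π × SendsPair π i j k l
    induced (g , Xg , g0 , sends) = perm g , (g , (Xg , ZeroShift.stabilises-W g g0) , λ _ → refl) , sends

  X-2-homogeneous : TwoHomogeneous (InducedBy X)
  X-2-homogeneous = 2-homogeneous-mono (λ { (g , (Xg , _) , g≈π) → g , Xg , g≈π }) X_W-2-homogeneous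

  -- Part (a): if δ = m then every codeword other than 0 is 1, so C = W.
  nontrivial⇒δ≢m : ¬ (∀ α → (C α → Rep α) × (Rep α → C α)) → δ ≢ m
  nontrivial⇒δ≢m C≢W δ≡m = C≢W λ α → C⇒W α , W⇒C α
    where
    C⇒W : ∀ α → C α → Rep α
    C⇒W α Cα with ≡-dec Bool._≟_ α zeroV
    ... | yes α≡0 = inj₁ α≡0
    ... | no  α≢0 = inj₂ (full-weight⇒1 α (subst (_≤ dist zeroV α) δ≡m
                           (proj₂ δ-minimum zeroV α 0∈C Cα (λ 0≡α → α≢0 (sym 0≡α)))))
    W⇒C : ∀ α → Rep α → C α
    W⇒C α (inj₁ refl) = 0∈C
    W⇒C α (inj₂ refl) = 1∈C

  Mixed : Set
  Mixed = ∃ λ c → C c × ∃ λ k → ∃ λ l → parityAt k l c ≡ true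

  -- A codeword at distance δ from 0 is neither 0 nor (when δ ≠ m) 1.
  mixed-codeword : δ ≢ m → Mixed
  mixed-codeword δ≢m with proj₁ δ-minimum
  ... | c , c′ , Cc , Cc′ , _ , dcc′≡δ with X-transitive-on-C c zeroV Cc 0∈C
  ... | g , Xg , gc≡0 = act g c′ , X-preserves-C Xg Cc′ , non-constant ≢0 ≢1
    where
    weight : dist zeroV (act g c′) ≡ δ
    weight = trans (cong (λ v → dist v _) (sym gc≡0)) (trans (dist-act g c c′) dcc′≡δ)
    ≢0 : act g c′ ≢ zeroV
    ≢0 gc′≡0 = <⇒≱ (≤-trans (s≤s z≤n) 5≤δ)
      (≤-reflexive (trans (sym weight) (trans (cong (dist zeroV) gc′≡0) (dist-self (zeroV {m})))))
    ≢1 : act g c′ ≢ oneV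
    ≢1 gc′≡1 = δ≢m (trans (sym weight) (trans (cong (dist zeroV) gc′≡1) dist-0-1))

  fixer-through : ∀ g h {i j} → X g → X h → Rep (shift h) →
    Sends (perm h) i j (perm g ⟨$⟩ˡ i) (perm g ⟨$⟩ˡ j) →
    Fix2 X i j (g · h) × parity i j (g · h) ≡ parity i j g
  fixer-through g h {i} {j} Xg Xh rep (hi , hj) =
    (mul Xg Xh , ·-sends g h hi , ·-sends g h hj) ,
    trans (parity-· g h refl refl) (cong (_xor parity i j g) (Rep-parity rep (perm g ⟨$⟩ˡ i) (perm g ⟨$⟩ˡ j)))

  Interchange : Set
  Interchange = ∃ λ x → ∃ λ y → x ≢ y × ∃ λ s → InducedBy X s × Sends s x y y x

  -- An element fixing k and l with odd parity there has a power inducing an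
  -- interchange: its parities alternate, while powers acting trivially on M
  -- lie in K and have even parity.
  odd-fixer⇒interchange : ∀ {f k l} → Fix2 X k l f → parity k l f ≡ true → Interchange
  odd-fixer⇒interchange {f} {k} {l} (Xf , fk , fl) odd =
    from-involution (involutive-power (perm f) trivial⇒even)
    where
    power : ℕ → Aut m
    power zero    = idA
    power (suc n) = f · power n
    X-power : ∀ n → X (power n)
    X-power zero    = hasId
    X-power (suc n) = mul Xf (X-power n)
    perm-power : ∀ n x → perm (power n) ⟨$⟩ʳ x ≡ (perm f ^ n) x
    perm-power zero    x = refl
    perm-power (suc n) x = cong (perm f ⟨$⟩ʳ_) (perm-power n x)
    parity-alternates : ∀ n → parity k l (power (suc n)) ≡ not (parity k l (power n))
    parity-alternates n = begin
      parity k l (f · power n)               ≡⟨ parity-· f (power n) (⟨$⟩ˡ-of (perm f) fk) (⟨$⟩ˡ-of (perm f) fl) ⟩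
      parity k l (power n) xor parity k l f  ≡⟨ cong (parity k l (power n) xor_) odd ⟩
      parity k l (power n) xor true          ≡⟨ xor-comm _ true ⟩
      true xor parity k l (power n)          ≡⟨ true-xor _ ⟩
      not (parity k l (power n))             ∎
    trivial⇒even : ∀ n → Trivial (perm f) n → Even n
    trivial⇒even n trivial = alternating⇒even (λ n → parity k l (power n))
      (Rep-parity (inj₁ refl) k l) parity-alternates n
      (K-parity (X-power n) (λ x → trans (perm-power n x) (trivial x)) k l)
    from-involution : (∃ λ x → ∃ λ r → (perm f ^ r) x ≢ x × (perm f ^ r) ((perm f ^ r) x) ≡ x) → Interchange
    from-involution (x , r , moved , back) =
      x , (perm f ^ r) x , (λ x≡ → moved (sym x≡)) ,
      perm (power r) , (power r , X-power r , λ _ → refl) , perm-power r x , trans (perm-power r _) back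

  -- A mixed codeword c yields an interchange: translating 0 to c and
  -- correcting by a zero-shift element either interchanges the two entries
  -- where c differs or fixes them with odd parity.
  interchange-exists : Mixed → Interchange
  interchange-exists (c , Cc , k , l , odd) =
    let (g , Xg , g≡c) = translate-to Cc
    in  correct g Xg g≡c (pairs-moved k≢l (λ e → k≢l (⟨$⟩ˡ-injective (perm g) e)))
    where
    k≢l : k ≢ l
    k≢l = odd⇒distinct c odd
    correct : ∀ g → X g → shift g ≡ c →
      (∃ λ h → X h × shift h ≡ zeroV × SendsPair (perm h) k l (perm g ⟨$⟩ˡ k) (perm g ⟨$⟩ˡ l)) →
      Interchange
    correct g Xg g≡c (h , Xh , h0 , inj₁ sends) =
      let (fixer , same-parity) = fixer-through g h Xg Xh (inj₁ h0) sends
      in  odd-fixer⇒interchange fixer (trans same-parity (trans (cong (parityAt k l) g≡c) odd))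
    correct g Xg g≡c (h , Xh , h0 , inj₂ (hk , hl)) =
      k , l , k≢l , perm (g · h) , (g · h , mul Xg Xh , λ _ → refl) , ·-sends g h hk , ·-sends g h hl

  X-2-transitive : Mixed → TwoTransitive (InducedBy X)
  X-2-transitive mixed = from-interchange (interchange-exists mixed)
    where
    from-interchange : Interchange → TwoTransitive (InducedBy X)
    from-interchange (x , y , x≢y , s , Xs , sends) =
      homogeneous-with-interchange⇒2-transitive {G = InducedBy X} (λ {π} {ρ} → induced-∘ X-subgroup {π} {ρ})
        X-2-homogeneous s x≢y Xs sends

  module IndexTwo (X_W-2-transitive : TwoTransitive (InducedBy (StabW X Rep)))
                  {i j : Fin m} (i≢j : i ≢ j) where

    Fixer : Aut m → Set
    Fixer = Fix2 X i j

    fixer-· : ∀ g h → Fixer g → Fixer h → Fixer (g · h)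
    fixer-· g h (Xg , gi , gj) (Xh , hi , hj) =
      mul Xg Xh , trans (cong (perm g ⟨$⟩ʳ_) hi) gi , trans (cong (perm g ⟨$⟩ʳ_) hj) gj

    fixer-inv : ∀ g → Fixer g → Fixer (invA g)
    fixer-inv g (Xg , gi , gj) = inv Xg , ⟨$⟩ˡ-of (perm g) gi , ⟨$⟩ˡ-of (perm g) gj

    parity-fixer-· : ∀ g h → Fixer g → parity i j (g · h) ≡ parity i j h xor parity i j g
    parity-fixer-· g h (_ , gi , gj) = parity-· g h (⟨$⟩ˡ-of (perm g) gi) (⟨$⟩ˡ-of (perm g) gj)

    parity-fixer-inv : ∀ g → Fixer g → parity i j (invA g) ≡ parity i j g
    parity-fixer-inv g (_ , gi , gj) = parity-inv g gi gj

    -- Parity depends only on the induced permutation, since g h⁻¹ ∈ K.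
    parity-well-defined : ∀ g h → Fixer g → Fixer h → perm g P.≈ perm h → parity i j g ≡ parity i j h
    parity-well-defined g h Fg Fh g≈h = sym (xor≡false⇒≡ (begin
      parity i j h xor parity i j g         ≡⟨ cong (_xor parity i j g) (parity-fixer-inv h Fh) ⟨
      parity i j (invA h) xor parity i j g  ≡⟨ parity-fixer-· g (invA h) Fg ⟨
      parity i j (g · invA h)               ≡⟨ K-parity (mul (proj₁ Fg) (inv (proj₁ Fh))) trivial i j ⟩
      false                                 ∎))
      where
      trivial : perm (g · invA h) P.≈ P.id
      trivial x = trans (g≈h (perm h ⟨$⟩ˡ x)) (P.inverseʳ (perm h))

    -- Moving a mixed codeword by X_W gives a codeword differing at i and j.
    odd-codeword : Mixed → ∃ λ c → C c × parityAt i j c ≡ true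
    odd-codeword (c , Cc , k , l , odd) = moved (X_W-2-transitive k l i j (odd⇒distinct c odd) i≢j)
      where
      moved : (∃ λ π → InducedBy (StabW X Rep) π × Sends π k l i j) → ∃ λ c → C c × parityAt i j c ≡ true
      moved (_ , (h , (Xh , h-stab) , h≈) , hk , hl) = act h c , X-preserves-C Xh Cc , (begin
        parityAt i j (act h c)                                ≡⟨ cong₂ (λ a b → parityAt a b (act h c)) (trans (h≈ k) hk) (trans (h≈ l) hl) ⟨
        parityAt (perm h ⟨$⟩ʳ k) (perm h ⟨$⟩ʳ l) (act h c)    ≡⟨ parity-act h (shift-of-stabiliser h h-stab) c k l ⟩
        parityAt k l c                                        ≡⟨ odd ⟩
        true                                                  ∎)

    -- Translating that codeword to 0 and correcting by X_W gives an
    -- element of X_{i,j} with odd parity.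
    odd-fixer : Mixed → ∃ λ f → Fixer f × parity i j f ≡ true
    odd-fixer mixed =
      let (c , Cc , c-odd) = odd-codeword mixed
          (g , Xg , g≡c)   = translate-to Cc
      in  correct g Xg (trans (cong (parityAt i j) g≡c) c-odd)
            (X_W-2-transitive i j (perm g ⟨$⟩ˡ i) (perm g ⟨$⟩ˡ j) i≢j (λ e → i≢j (⟨$⟩ˡ-injective (perm g) e)))
      where
      correct : ∀ g → X g → parity i j g ≡ true →
        (∃ λ π → InducedBy (StabW X Rep) π × Sends π i j (perm g ⟨$⟩ˡ i) (perm g ⟨$⟩ˡ j)) →
        ∃ λ f → Fixer f × parity i j f ≡ true
      correct g Xg g-odd (_ , (h , (Xh , h-stab) , h≈) , hi , hj) =
        let (fixer , same-parity) = fixer-through g h Xg Xh (shift-of-stabiliser h h-stab) (trans (h≈ i) hi , trans (h≈ j) hj)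
        in  g · h , fixer , trans same-parity g-odd

    Even-part : Permutation′ m → Set
    Even-part π = ∃ λ g → Fixer g × perm g P.≈ π × parity i j g ≡ false

    even-part-normal : ∀ {a π} → InducedBy Fixer a → Even-part π → Even-part (P.flip a ∘ₚ (π ∘ₚ a))
    even-part-normal {a} {π} (g′ , Fg′ , g′≈a) (g , Fg , g≈π , even) =
      g′ · (g · invA g′) , fixer-· g′ (g · invA g′) Fg′ (fixer-· g (invA g′) Fg (fixer-inv g′ Fg′)) ,
      conjugate , (begin
        parity i j (g′ · (g · invA g′))
          ≡⟨ parity-fixer-· g′ (g · invA g′) Fg′ ⟩
        parity i j (g · invA g′) xor parity i j g′
          ≡⟨ cong (_xor parity i j g′) (parity-fixer-· g (invA g′) Fg) ⟩
        (parity i j (invA g′) xor parity i j g) xor parity i j g′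
          ≡⟨ cong (λ b → (parity i j (invA g′) xor b) xor parity i j g′) even ⟩
        (parity i j (invA g′) xor false) xor parity i j g′
          ≡⟨ cong (_xor parity i j g′) (trans (xor-identityʳ (parity i j (invA g′))) (parity-fixer-inv g′ Fg′)) ⟩
        parity i j g′ xor parity i j g′
          ≡⟨ xor-same (parity i j g′) ⟩
        false ∎)
      where
      conjugate : perm (g′ · (g · invA g′)) P.≈ (P.flip a ∘ₚ (π ∘ₚ a))
      conjugate x = trans (cong (perm g′ ⟨$⟩ʳ_) (trans (cong (perm g ⟨$⟩ʳ_) (flip-cong (perm g′) a g′≈a x))
                                                         (g≈π (a ⟨$⟩ˡ x))))
                          (g′≈a (π ⟨$⟩ʳ (a ⟨$⟩ˡ x)))

    even-part-cosets : ∀ a → InducedBy Fixer a → ¬ Even-part a →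
      ∀ π → InducedBy Fixer π → Even-part π ⊎ Even-part (π ∘ₚ P.flip a)
    even-part-cosets a (a₀ , Fa₀ , a₀≈a) a-odd π (g , Fg , g≈π) with parity i j g in pg | parity i j a₀ in pa
    ... | false | _     = inj₁ (g , Fg , g≈π , pg)
    ... | true  | false = ⊥-elim (a-odd (a₀ , Fa₀ , a₀≈a , pa))
    ... | true  | true  = inj₂ (invA a₀ · g , fixer-· (invA a₀) g (fixer-inv a₀ Fa₀) Fg ,
          (λ x → trans (flip-cong (perm a₀) a a₀≈a (perm g ⟨$⟩ʳ x)) (cong (a ⟨$⟩ˡ_) (g≈π x))) ,
          trans (parity-fixer-· (invA a₀) g (fixer-inv a₀ Fa₀)) (cong₂ _xor_ pg (trans (parity-fixer-inv a₀ Fa₀) pa)))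

    even-part-index-2 : Mixed → NormalIndex2 (InducedBy Fixer) Even-part
    even-part-index-2 mixed = record
      { resp    = λ { π≈ρ (g , Fg , g≈π , even) → g , Fg , (λ x → trans (g≈π x) (π≈ρ x)) , even }
      ; sub     = λ { (g , Fg , g≈π , _) → g , Fg , g≈π }
      ; hasId   = idA , (hasId , refl , refl) , (λ _ → refl) , Rep-parity (inj₁ refl) i j
      ; mul     = λ { {π} {ρ} (g , Fg , g≈π , eg) (h , Fh , h≈ρ , eh) →
                      h · g , fixer-· h g Fh Fg , (λ x → trans (cong (perm h ⟨$⟩ʳ_) (g≈π x)) (h≈ρ (π ⟨$⟩ʳ x))) ,
                      trans (parity-fixer-· h g Fh) (cong₂ _xor_ eg eh) }
      ; inv     = λ { {π} (g , Fg , g≈π , even) → invA g , fixer-inv g Fg , flip-cong (perm g) π g≈π ,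
                      trans (parity-fixer-inv g Fg) even }
      ; normal  = λ {a} {π} → even-part-normal {a} {π}
      ; outside = outside
      ; cosets  = even-part-cosets
      }
      where
      outside : ∃ λ a → InducedBy Fixer a × ¬ Even-part a
      outside =
        let (f , Ff , odd) = odd-fixer mixed
        in  perm f , (f , Ff , λ _ → refl) , λ { (g , Fg , g≈f , even) →
              Bool.not-¬ (trans (parity-well-defined f g Ff Fg (λ x → sym (g≈f x))) even) odd }

lemma3p5 : (m : ℕ) (X : Aut m → Set) (C : Code m) →
    IsSubgroup X →
    IsExtension X Rep C →
    ¬ (∀ α → (C α → Rep α) × (Rep α → C α)) →
    (δ : ℕ) → IsMinDist C δ → 5 ≤ δ →
    (δ ≢ m)
    × TwoTransitive (InducedBy X)
    × TwoHomogeneous (InducedBy (StabW X Rep))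
    × (TwoTransitive (InducedBy (StabW X Rep)) →
    ∀ (i j : Fin m) → i ≢ j → HasNormalIndex2 (InducedBy (Fix2 X i j)))
lemma3p5 m X C X-subgroup C-extension C≢W δ δ-minimum 5≤δ =
  δ≢m , X-2-transitive mixed , X_W-2-homogeneous , index-two
  where
  open NeighbourTransitiveExtension X-subgroup C-extension δ-minimum 5≤δ
  δ≢m : δ ≢ m
  δ≢m = nontrivial⇒δ≢m C≢W
  mixed : Mixed
  mixed = mixed-codeword δ≢m
  index-two : TwoTransitive (InducedBy (StabW X Rep)) →
    ∀ i j → i ≢ j → HasNormalIndex2 (InducedBy (Fix2 X i j))
  index-two X_W-2-transitive i j i≢j = Even-part , even-part-index-2 mixed
    where open IndexTwo X_W-2-transitive i≢j
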